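{- Let $n=4k^2$ where $k$ is an odd positive integer. If there exists a pair of unbiased Hadamard matrices of order $n$, then there exists a pair of Type~II weakly unbiased Hadamard matrices $H,K$ of order $n$ with $\sigma(H,K)=\{\sqrt n-2,\sqrt n+2\}$.
   Context: A Hadamard matrix of order $n$ is an $n\times n$ $(\pm1)$-matrix $H$ with $HH^T=nI_n$. Hadamard matrices $H,K$ of order $n$ are unbiased if $\frac1{\sqrt n}HK^T$ is a Hadamard matrix. For Hadamard matrices $H,K$ with $a_{ij}$ the $(i,j)$-entry of $HK^T$, $\sigma(H,K)=\{|a_{ij}|\}$. $H,K$ are Type~II weakly unbiased if $a_{ij}\equiv0\pmod4$ for all $i,j$ and $|\sigma(H,K)|\le2$, unbiased pairs being excluded. -}

module Defs where

open import Data.Nat using (ℕ; suc; zero) renaming (_*_ to _*ℕ_)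
open import Data.Fin using (Fin) renaming (zero to fzero; suc to fsuc; _≟_ to _≟F_)
open import Relation.Nullary using (yes; no)
open import Data.Integer using (ℤ; +_; -[1+_]; _*_; _+_; ∣_∣)
open import Data.Integer.Divisibility using () renaming (_∣_ to _∣ℤ_)
open import Data.Product using (_×_; ∃; ∃-syntax; Σ-syntax)
open import Data.Sum using (_⊎_)
open import Relation.Binary.PropositionalEquality using (_≡_)
open import Relation.Nullary using (¬_)

Matrix : ℕ → Set
Matrix n = Fin n → Fin n → ℤ

sumFin : (n : ℕ) → (Fin n → ℤ) → ℤ
sumFin zero    f = + 0
sumFin (suc n) f = f fzero + sumFin n (λ j → f (fsuc j))

mulT : {n : ℕ} → Matrix n → Matrix n → Matrix n
mulT {n} A B i j = sumFin n (λ t → A i t * B j t)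

scaledId : {n : ℕ} → ℤ → Matrix n
scaledId c i j with i ≟F j
... | yes _ = c
... | no  _ = + 0

IsPM1 : {n : ℕ} → Matrix n → Set
IsPM1 M = ∀ i j → (M i j ≡ + 1) ⊎ (M i j ≡ -[1+ 0 ])

IsHadamard : (n : ℕ) → Matrix n → Set
IsHadamard n H = IsPM1 H × (∀ i j → mulT H H i j ≡ scaledId (+ n) i j)

-- H, K unbiased: (1/√n) H Kᵀ is a Hadamard matrix, i.e. √n = m ∈ ℕ
-- (entries of H Kᵀ are integers) and H Kᵀ = m L with L Hadamard.
Unbiased : (n : ℕ) → Matrix n → Matrix n → Set
Unbiased n H K =
  IsHadamard n H × IsHadamard n K ×
  ∃[ m ] (m *ℕ m ≡ n) ×
    (∃[ L ] IsHadamard n L × (∀ i j → mulT H K i j ≡ + m * L i j))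

InSigma : {n : ℕ} → Matrix n → Matrix n → ℕ → Set
InSigma H K x = ∃[ i ] ∃[ j ] ∣ mulT H K i j ∣ ≡ x

SigmaAtMostTwo : {n : ℕ} → Matrix n → Matrix n → Set
SigmaAtMostTwo H K = ∃[ u ] ∃[ v ] (∀ x → InSigma H K x → (x ≡ u) ⊎ (x ≡ v))

TypeIIWeaklyUnbiased : (n : ℕ) → Matrix n → Matrix n → Set
TypeIIWeaklyUnbiased n H K =
  IsHadamard n H × IsHadamard n K ×
  (∀ i j → (+ 4) ∣ℤ mulT H K i j) ×
  SigmaAtMostTwo H K ×
  ¬ Unbiased n H K

SigmaEquals : {n : ℕ} → Matrix n → Matrix n → ℕ → ℕ → Set
SigmaEquals H K a b =
  (∀ x → InSigma H K x → (x ≡ a) ⊎ (x ≡ b)) × InSigma H K a × InSigma H K b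

-- Negating the first column of K changes every entry of H Kᵀ by -2 H_{i1} K_{j1}.
-- If H Kᵀ = m L with L Hadamard, each new entry is m L_{ij} - 2 H_{i1} K_{j1}, of
-- absolute value m - 2 or m + 2 according as the signs L_{ij} and H_{i1} K_{j1}
-- agree or not.  Both cases occur, since a Hadamard matrix of order at least 2 is
-- not of rank one, and neither value is m, so the new pair is not unbiased.  For
-- m = 2k with k odd, both m - 2 and m + 2 are multiples of 4.
module Submission where

open import Defs
open import Data.Nat using (ℕ; suc; _*_; _+_; _∸_)
open import Data.Product using (_×_; ∃-syntax)

open import Data.Nat as ℕ using (zero; _≤_; z≤n; s≤s)
import Data.Nat.Properties as ℕ
open import Data.Nat.Divisibility using (_∣_; m∣m*n)
open import Data.Nat.Tactic.RingSolver using (solve-∀)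
open import Data.Integer as ℤ using (ℤ; +_; -[1+_]; ∣_∣; -_; _-_)
import Data.Integer.Properties as ℤ
open import Data.Integer.Divisibility using () renaming (_∣_ to _∣ℤ_)
import Data.Integer.Tactic.RingSolver as ℤ-Ring
open import Data.Fin using (Fin) renaming (zero to fzero; suc to fsuc)
open import Data.Fin.Properties using (any?)
open import Data.Product using (_,_; proj₁)
open import Data.Sum using (_⊎_; inj₁; inj₂)
open import Data.Empty using (⊥-elim)
open import Relation.Nullary using (¬_; yes; no)
open import Relation.Binary.PropositionalEquality
open import Relation.Binary.Definitions using (tri<; tri≈; tri>)

*-self-injective : ∀ {m n} → m * m ≡ n * n → m ≡ n
*-self-injective {m} {n} eq with ℕ.<-cmp m n
... | tri< m<n _ _ = ⊥-elim (ℕ.<-irrefl eq (ℕ.*-mono-< m<n m<n))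
... | tri≈ _ m≡n _ = m≡n
... | tri> _ _ n<m = ⊥-elim (ℕ.<-irrefl (sym eq) (ℕ.*-mono-< n<m n<m))

sumFin-cong : ∀ n {f g : Fin n → ℤ} → (∀ t → f t ≡ g t) → sumFin n f ≡ sumFin n g
sumFin-cong zero    f≗g = refl
sumFin-cong (suc n) f≗g = cong₂ ℤ._+_ (f≗g fzero) (sumFin-cong n (λ t → f≗g (fsuc t)))

sumFin-const : ∀ n c → sumFin n (λ _ → c) ≡ + n ℤ.* c
sumFin-const zero    c = sym (ℤ.*-zeroˡ c)
sumFin-const (suc n) c = begin
  c ℤ.+ sumFin n (λ _ → c)   ≡⟨ cong₂ ℤ._+_ (sym (ℤ.*-identityˡ c)) (sumFin-const n c) ⟩
  + 1 ℤ.* c ℤ.+ + n ℤ.* c    ≡⟨ ℤ.*-distribʳ-+ c (+ 1) (+ n) ⟨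
  + suc n ℤ.* c              ∎
  where open ≡-Reasoning

IsSign : ℤ → Set
IsSign x = (x ≡ + 1) ⊎ (x ≡ -[1+ 0 ])

sign-neg : ∀ {a} → IsSign a → IsSign (- a)
sign-neg (inj₁ refl) = inj₂ refl
sign-neg (inj₂ refl) = inj₁ refl

sign-* : ∀ {a b} → IsSign a → IsSign b → IsSign (a ℤ.* b)
sign-* (inj₁ refl) (inj₁ refl) = inj₁ refl
sign-* (inj₁ refl) (inj₂ refl) = inj₂ refl
sign-* (inj₂ refl) (inj₁ refl) = inj₂ refl
sign-* (inj₂ refl) (inj₂ refl) = inj₁ refl

sign-≡-⊎-≡-neg : ∀ {a b} → IsSign a → IsSign b → (a ≡ b) ⊎ (a ≡ - b)
sign-≡-⊎-≡-neg (inj₁ refl) (inj₁ refl) = inj₁ refl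
sign-≡-⊎-≡-neg (inj₁ refl) (inj₂ refl) = inj₂ refl
sign-≡-⊎-≡-neg (inj₂ refl) (inj₁ refl) = inj₂ refl
sign-≡-⊎-≡-neg (inj₂ refl) (inj₂ refl) = inj₁ refl

sign≢0 : ∀ {a} → IsSign a → a ≢ + 0
sign≢0 (inj₁ refl) ()
sign≢0 (inj₂ refl) ()

sign-square : ∀ {s} → IsSign s → s ℤ.* s ≡ + 1
sign-square (inj₁ refl) = refl
sign-square (inj₂ refl) = refl

*-sign-cancel : ∀ a b {s} → IsSign s → (a ℤ.* s) ℤ.* (b ℤ.* s) ≡ a ℤ.* b
*-sign-cancel a b {s} ±s = begin
  (a ℤ.* s) ℤ.* (b ℤ.* s)   ≡⟨ regroup a b s ⟩
  (a ℤ.* b) ℤ.* (s ℤ.* s)   ≡⟨ cong ((a ℤ.* b) ℤ.*_) (sign-square ±s) ⟩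
  (a ℤ.* b) ℤ.* + 1         ≡⟨ ℤ.*-identityʳ (a ℤ.* b) ⟩
  a ℤ.* b                   ∎
  where
  open ≡-Reasoning
  regroup : ∀ a b s → (a ℤ.* s) ℤ.* (b ℤ.* s) ≡ (a ℤ.* b) ℤ.* (s ℤ.* s)
  regroup = ℤ-Ring.solve-∀

∣*sign∣ : ∀ x {a} → IsSign a → ∣ x ℤ.* a ∣ ≡ ∣ x ∣
∣*sign∣ x (inj₁ refl) = cong ∣_∣ (ℤ.*-identityʳ x)
∣*sign∣ x (inj₂ refl) = begin
  ∣ x ℤ.* -[1+ 0 ] ∣   ≡⟨ cong ∣_∣ (ℤ.neg-distribʳ-* x (+ 1)) ⟨
  ∣ - (x ℤ.* + 1) ∣    ≡⟨ ℤ.∣-i∣≡∣i∣ (x ℤ.* + 1) ⟩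
  ∣ x ℤ.* + 1 ∣        ≡⟨ cong ∣_∣ (ℤ.*-identityʳ x) ⟩
  ∣ x ∣                ∎
  where open ≡-Reasoning

∣x*a-y*a∣ : ∀ x y {a} → IsSign a → ∣ x ℤ.* a - y ℤ.* a ∣ ≡ ∣ x - y ∣
∣x*a-y*a∣ x y {a} ±a = trans (cong ∣_∣ (factor x y a)) (∣*sign∣ (x - y) ±a)
  where
  factor : ∀ x y a → x ℤ.* a - y ℤ.* a ≡ (x - y) ℤ.* a
  factor = ℤ-Ring.solve-∀

∣x*-a-y*a∣ : ∀ x y {a} → IsSign a → ∣ x ℤ.* (- a) - y ℤ.* a ∣ ≡ ∣ x ℤ.+ y ∣
∣x*-a-y*a∣ x y {a} ±a = begin
  ∣ x ℤ.* (- a) - y ℤ.* a ∣    ≡⟨ cong ∣_∣ (factor x y a) ⟩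
  ∣ - ((x ℤ.+ y) ℤ.* a) ∣      ≡⟨ ℤ.∣-i∣≡∣i∣ ((x ℤ.+ y) ℤ.* a) ⟩
  ∣ (x ℤ.+ y) ℤ.* a ∣          ≡⟨ ∣*sign∣ (x ℤ.+ y) ±a ⟩
  ∣ x ℤ.+ y ∣                  ∎
  where
  open ≡-Reasoning
  factor : ∀ x y a → x ℤ.* (- a) - y ℤ.* a ≡ - ((x ℤ.+ y) ℤ.* a)
  factor = ℤ-Ring.solve-∀

hadamard-notRankOne : ∀ {n} {L : Matrix (suc (suc n))} {u v : Fin (suc (suc n)) → ℤ} →
  IsHadamard (suc (suc n)) L → (∀ i → IsSign (u i)) → (∀ j → IsSign (v j)) →
  ¬ (∀ i j → L i j ≡ u i ℤ.* v j)
hadamard-notRankOne {n} {L} {u} {v} (_ , LLᵀ≡NI) ±u ±v L≡uvᵀ =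
  sign≢0 (sign-* (±u fzero) (±u (fsuc fzero))) u₀u₁≡0
  where
  N = suc (suc n)
  u₀u₁ = u fzero ℤ.* u (fsuc fzero)
  rows₀₁-orthogonal : + N ℤ.* u₀u₁ ≡ + 0
  rows₀₁-orthogonal = begin
    + N ℤ.* u₀u₁                     ≡⟨ sumFin-const N u₀u₁ ⟨
    sumFin N (λ _ → u₀u₁)            ≡⟨ sumFin-cong N (λ t → sym (trans
                                          (cong₂ ℤ._*_ (L≡uvᵀ fzero t) (L≡uvᵀ (fsuc fzero) t))
                                          (*-sign-cancel (u fzero) (u (fsuc fzero)) (±v t)))) ⟩
    mulT L L fzero (fsuc fzero)      ≡⟨ LLᵀ≡NI fzero (fsuc fzero) ⟩
    + 0                              ∎
    where open ≡-Reasoning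
  u₀u₁≡0 : u₀u₁ ≡ + 0
  u₀u₁≡0 with ℤ.i*j≡0⇒i≡0∨j≡0 (+ N) rows₀₁-orthogonal
  ... | inj₁ ()
  ... | inj₂ u₀u₁≡0 = u₀u₁≡0

hadamard-agrees-rankOne : ∀ {n} {L : Matrix (suc (suc n))} {u v : Fin (suc (suc n)) → ℤ} →
  IsHadamard (suc (suc n)) L → (∀ i → IsSign (u i)) → (∀ j → IsSign (v j)) →
  ∃[ i ] ∃[ j ] L i j ≡ u i ℤ.* v j
hadamard-agrees-rankOne {L = L} {u} {v} hL@(±L , _) ±u ±v
  with any? (λ i → any? (λ j → L i j ℤ.≟ u i ℤ.* v j))
... | yes agreement = agreement
... | no  ¬agreement =
  ⊥-elim (hadamard-notRankOne hL (λ i → sign-neg (±u i)) ±v L≡-uvᵀ)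
  where
  L≡-uvᵀ : ∀ i j → L i j ≡ (- u i) ℤ.* v j
  L≡-uvᵀ i j with sign-≡-⊎-≡-neg (±L i j) (sign-* (±u i) (±v j))
  ... | inj₁ agree    = ⊥-elim (¬agreement (i , j , agree))
  ... | inj₂ disagree = trans disagree (ℤ.neg-distribˡ-* (u i) (v j))

unbiased⇒∣entry∣≡√n : ∀ {n m H K} → m * m ≡ n → Unbiased n H K → ∀ i j → ∣ mulT H K i j ∣ ≡ m
unbiased⇒∣entry∣≡√n {m = m} {H} {K} m*m≡n (_ , _ , m′ , m′*m′≡n , L , (±L , _) , HKᵀ≡m′L) i j = begin
  ∣ mulT H K i j ∣       ≡⟨ cong ∣_∣ (HKᵀ≡m′L i j) ⟩
  ∣ + m′ ℤ.* L i j ∣     ≡⟨ ∣*sign∣ (+ m′) (±L i j) ⟩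
  m′                     ≡⟨ *-self-injective (trans m′*m′≡n (sym m*m≡n)) ⟩
  m                      ∎
  where open ≡-Reasoning

negateFirstColumn : ∀ {n} → Matrix (suc n) → Matrix (suc n)
negateFirstColumn K i fzero    = - K i fzero
negateFirstColumn K i (fsuc t) = K i (fsuc t)

negateFirstColumn-isHadamard : ∀ {n K} → IsHadamard (suc n) K → IsHadamard (suc n) (negateFirstColumn K)
negateFirstColumn-isHadamard {n} {K} (±K , KKᵀ≡nI) = ±K′ , K′K′ᵀ≡nI
  where
  ±K′ : IsPM1 (negateFirstColumn K)
  ±K′ i fzero    = sign-neg (±K i fzero)
  ±K′ i (fsuc t) = ±K i (fsuc t)
  neg-*-neg : ∀ a b → (- a) ℤ.* (- b) ≡ a ℤ.* b
  neg-*-neg = ℤ-Ring.solve-∀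
  K′K′ᵀ≡nI : ∀ i j → mulT (negateFirstColumn K) (negateFirstColumn K) i j ≡ scaledId (+ suc n) i j
  K′K′ᵀ≡nI i j = trans (cong (ℤ._+ sumFin n (λ t → K i (fsuc t) ℤ.* K j (fsuc t)))
                            (neg-*-neg (K i fzero) (K j fzero)))
                      (KKᵀ≡nI i j)

mulT-negateFirstColumn : ∀ {n} (H K : Matrix (suc n)) i j →
  mulT H (negateFirstColumn K) i j ≡ mulT H K i j - + 2 ℤ.* (H i fzero ℤ.* K j fzero)
mulT-negateFirstColumn {n} H K i j =
  shift (H i fzero) (K j fzero) (sumFin n (λ t → H i (fsuc t) ℤ.* K j (fsuc t)))
  where
  shift : ∀ x y s → x ℤ.* (- y) ℤ.+ s ≡ (x ℤ.* y ℤ.+ s) - + 2 ℤ.* (x ℤ.* y)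
  shift = ℤ-Ring.solve-∀

-- The order is written (2 + p) * (2 + p) so that it reduces to the form suc (suc _),
-- which makes the indices 0 and 1 available to the lemmas above.
module NegateFirstColumnOfUnbiased
  {p : ℕ} {H K L : Matrix ((2 + p) * (2 + p))}
  (hH : IsHadamard _ H) (hK : IsHadamard _ K) (hL : IsHadamard _ L)
  (HKᵀ≡mL : ∀ i j → mulT H K i j ≡ + (2 + p) ℤ.* L i j)
  where

  m : ℕ
  m = 2 + p

  K′ : Matrix (m * m)
  K′ = negateFirstColumn K

  a : Fin (m * m) → Fin (m * m) → ℤ
  a i j = H i fzero ℤ.* K j fzero

  ±a : ∀ i j → IsSign (a i j)
  ±a i j = sign-* (proj₁ hH i fzero) (proj₁ hK j fzero)

  HK′ᵀ≡mL-2a : ∀ i j → mulT H K′ i j ≡ + m ℤ.* L i j - + 2 ℤ.* a i j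
  HK′ᵀ≡mL-2a i j = trans (mulT-negateFirstColumn H K i j) (cong (_- + 2 ℤ.* a i j) (HKᵀ≡mL i j))

  ∣entry∣-agree : ∀ {i j} → L i j ≡ a i j → ∣ mulT H K′ i j ∣ ≡ m ∸ 2
  ∣entry∣-agree {i} {j} L≡a = begin
    ∣ mulT H K′ i j ∣                    ≡⟨ cong ∣_∣ (HK′ᵀ≡mL-2a i j) ⟩
    ∣ + m ℤ.* L i j - + 2 ℤ.* a i j ∣    ≡⟨ cong (λ l → ∣ + m ℤ.* l - + 2 ℤ.* a i j ∣) L≡a ⟩
    ∣ + m ℤ.* a i j - + 2 ℤ.* a i j ∣    ≡⟨ ∣x*a-y*a∣ (+ m) (+ 2) (±a i j) ⟩
    ∣ + m - + 2 ∣                        ≡⟨⟩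
    m ∸ 2                                ∎
    where open ≡-Reasoning

  ∣entry∣-disagree : ∀ {i j} → L i j ≡ - a i j → ∣ mulT H K′ i j ∣ ≡ m + 2
  ∣entry∣-disagree {i} {j} L≡-a = begin
    ∣ mulT H K′ i j ∣                    ≡⟨ cong ∣_∣ (HK′ᵀ≡mL-2a i j) ⟩
    ∣ + m ℤ.* L i j - + 2 ℤ.* a i j ∣    ≡⟨ cong (λ l → ∣ + m ℤ.* l - + 2 ℤ.* a i j ∣) L≡-a ⟩
    ∣ + m ℤ.* (- a i j) - + 2 ℤ.* a i j ∣ ≡⟨ ∣x*-a-y*a∣ (+ m) (+ 2) (±a i j) ⟩
    ∣ + m ℤ.+ + 2 ∣                      ≡⟨⟩
    m + 2                                ∎
    where open ≡-Reasoning

  ∣entry∣∈ : ∀ i j → (∣ mulT H K′ i j ∣ ≡ m ∸ 2) ⊎ (∣ mulT H K′ i j ∣ ≡ m + 2)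
  ∣entry∣∈ i j with sign-≡-⊎-≡-neg (proj₁ hL i j) (±a i j)
  ... | inj₁ agree    = inj₁ (∣entry∣-agree agree)
  ... | inj₂ disagree = inj₂ (∣entry∣-disagree disagree)

  σ⊆ : ∀ x → InSigma H K′ x → (x ≡ m ∸ 2) ⊎ (x ≡ m + 2)
  σ⊆ x (i , j , ∣entry∣≡x) with ∣entry∣∈ i j
  ... | inj₁ ∣entry∣≡m-2 = inj₁ (trans (sym ∣entry∣≡x) ∣entry∣≡m-2)
  ... | inj₂ ∣entry∣≡m+2 = inj₂ (trans (sym ∣entry∣≡x) ∣entry∣≡m+2)

  m-2∈σ : InSigma H K′ (m ∸ 2)
  m-2∈σ with hadamard-agrees-rankOne hL (λ i → proj₁ hH i fzero) (λ j → proj₁ hK j fzero)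
  ... | i , j , agree = i , j , ∣entry∣-agree agree

  m+2∈σ : InSigma H K′ (m + 2)
  m+2∈σ with hadamard-agrees-rankOne hL (λ i → sign-neg (proj₁ hH i fzero)) (λ j → proj₁ hK j fzero)
  ... | i , j , disagree =
    i , j , ∣entry∣-disagree (trans disagree (sym (ℤ.neg-distribˡ-* (H i fzero) (K j fzero))))

  σ≡ : SigmaEquals H K′ (m ∸ 2) (m + 2)
  σ≡ = σ⊆ , m-2∈σ , m+2∈σ

  m∉σ : ¬ InSigma H K′ m
  m∉σ m∈σ with σ⊆ m m∈σ
  ... | inj₁ m≡m-2 = ℕ.m+1+n≢n 1 m≡m-2
  ... | inj₂ m≡m+2 = ℕ.m+1+n≢m m (sym m≡m+2)

  ¬unbiased : ¬ Unbiased (m * m) H K′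
  ¬unbiased unbiased = m∉σ (fzero , fzero , unbiased⇒∣entry∣≡√n {m = m} refl unbiased fzero fzero)

unbiased⇒typeII-weaklyUnbiased : ∀ {n m} → m * m ≡ n → 2 ≤ m → 4 ∣ m ∸ 2 → 4 ∣ m + 2 →
  (∃[ H ] ∃[ K ] Unbiased n H K) →
  ∃[ H ] ∃[ K ] (TypeIIWeaklyUnbiased n H K × SigmaEquals H K (m ∸ 2) (m + 2))
unbiased⇒typeII-weaklyUnbiased {m = suc (suc p)} refl (s≤s (s≤s z≤n)) 4∣m-2 4∣m+2
  (H , K , hH , hK , m′ , m′*m′≡n , L , hL , HKᵀ≡m′L) =
  H , K′ , (hH , negateFirstColumn-isHadamard hK , 4∣entry , (m ∸ 2 , m + 2 , σ⊆) , ¬unbiased) , σ≡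
  where
  HKᵀ≡mL : ∀ i j → mulT H K i j ≡ + suc (suc p) ℤ.* L i j
  HKᵀ≡mL = subst (λ c → ∀ i j → mulT H K i j ≡ + c ℤ.* L i j) (*-self-injective {m′} m′*m′≡n) HKᵀ≡m′L
  open NegateFirstColumnOfUnbiased hH hK hL HKᵀ≡mL
  4∣entry : ∀ i j → + 4 ∣ℤ mulT H K′ i j
  4∣entry i j with ∣entry∣∈ i j
  ... | inj₁ ∣entry∣≡m-2 = subst (4 ∣_) (sym ∣entry∣≡m-2) 4∣m-2
  ... | inj₂ ∣entry∣≡m+2 = subst (4 ∣_) (sym ∣entry∣≡m+2) 4∣m+2

proposition8p3 : (r : ℕ) →
    let k = suc (2 * r) in
    let n = 4 * (k * k) in
    (∃[ H ] ∃[ K ] Unbiased n H K) →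
    ∃[ H ] ∃[ K ] (TypeIIWeaklyUnbiased n H K ×
                   SigmaEquals H K (2 * k ∸ 2) (2 * k + 2))
proposition8p3 r = unbiased⇒typeII-weaklyUnbiased (m*m≡4k² k) (ℕ.m≤m*n 2 k) 4∣m-2 4∣m+2
  where
  k = suc (2 * r)
  m*m≡4k² : ∀ k → (2 * k) * (2 * k) ≡ 4 * (k * k)
  m*m≡4k² = solve-∀
  m≡2+4r : ∀ r → 2 * suc (2 * r) ≡ 2 + 4 * r
  m≡2+4r = solve-∀
  m+2≡4[r+1] : ∀ r → 2 * suc (2 * r) + 2 ≡ 4 * (r + 1)
  m+2≡4[r+1] = solve-∀
  4∣m-2 : 4 ∣ 2 * k ∸ 2
  4∣m-2 = subst (λ m → 4 ∣ m ∸ 2) (sym (m≡2+4r r)) (m∣m*n r)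
  4∣m+2 : 4 ∣ 2 * k + 2
  4∣m+2 = subst (4 ∣_) (sym (m+2≡4[r+1] r)) (m∣m*n (r + 1))
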